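{- Let $n\ge4$ with $n\notin\{6,10\}$. Then $\gamma_e(P_n)\ge\left\lceil\frac{n+3}{2}\right\rceil$.
   Context: $P_n$ is the path on $n$ vertices $[x_1,\dots,x_n]$ with edges $\{x_i,x_{i+1}\}$. For a graph $\Gamma=(V,E)$ with distance $d$: a vertex $v$ carrying a positive integer label $\ell$ dominates exactly the vertices $u$ with $d(u,v)=\ell$; a vertex carrying label $0$ dominates only itself. An extended irregular dominating set is a set $S\subseteq V$ with an injective labeling $\lambda:S\to\{0,1,2,\dots\}$ such that every vertex of $V$ is dominated by some vertex of $S$, where some vertex of $S$ has label $0$. $\gamma_e(\Gamma)$ is the minimum cardinality of such a set. -}

module Defs where

open import Data.Nat using (ℕ; zero; suc; ∣_-_∣)
open import Data.Fin using (Fin; toℕ)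
open import Data.Product using (_×_; Σ; ∃; _,_; proj₁; proj₂)
open import Data.List using (List; map)
open import Data.List.Relation.Unary.Unique.Propositional using (Unique)
open import Data.List.Relation.Unary.Any using (Any)
open import Relation.Binary.PropositionalEquality using (_≡_)

-- The path P_n: vertex x_{i+1} is represented by i : Fin n, edges {i, i+1}.
-- Its graph distance is d(x_i, x_j) = |i - j|.
pathDist : {n : ℕ} → Fin n → Fin n → ℕ
pathDist i j = ∣ toℕ i - toℕ j ∣

Dominates : {n : ℕ} → Fin n × ℕ → Fin n → Set
Dominates (v , zero)  u = u ≡ v
Dominates (v , suc k) u = pathDist u v ≡ suc k

-- An extended irregular dominating set of P_n, given as a list of
-- (vertex, label) pairs: the set S is the list of vertices (no repeats),
-- the labelling λ is injective (labels pairwise distinct), some vertex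
-- has label 0, and every vertex is dominated by some member of S.
record ExtIrrDomSet (n : ℕ) : Set where
  field
    elems      : List (Fin n × ℕ)
    distinctV  : Unique (map proj₁ elems)
    injLabel   : Unique (map proj₂ elems)
    hasZero    : Any (λ p → proj₂ p ≡ 0) elems
    dominating : (u : Fin n) → Any (λ p → Dominates p u) elems

-- A labelled vertex dominates at most two vertices, and two only when its label ℓ satisfies
-- 2ℓ < n.  Labels being distinct, k labelled vertices dominate at most k + ⌊(n−1)/2⌋ vertices,
-- so a set with fewer than ⌈(n+3)/2⌉ elements is tight: every vertex is dominated exactly once
-- and every label 1, …, ⌊(n−1)/2⌋ is carried by a vertex dominating two vertices.  No tight set
-- exists.  For n = 2m+1 the label m sits at the centre and dominates both ends, so the label m−1,
-- which must sit next to the centre, reaches an end a second time.  For n = 2m, the vertex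
-- carrying m−i has its left end a_i < 2i, and two such vertices may share neither a vertex nor a
-- dominated vertex; a finite search shows that no choice of the a_i survives.  The case n = 4,
-- where the label 0 matters, is settled by hand.
module Submission where

open import Defs
open import Data.Nat using (ℕ; _≤_; ⌈_/2⌉; _+_)
open import Relation.Binary.PropositionalEquality using (_≢_)
open import Data.List using (length)

open import Data.Nat
open import Data.Nat.Properties
open import Data.Nat.Tactic.RingSolver using (solve-∀)
open import Data.Bool using (Bool; true; false; T; _∧_; _∨_)
open import Data.Bool.Properties using (T-∨; T-∧)
open import Data.Fin using (Fin; toℕ; fromℕ<)
open import Data.Fin.Patterns using (0F; 1F; 2F; 3F)
open import Data.Fin.Properties using (toℕ<n; toℕ-fromℕ<; toℕ-injective)
open import Data.List using (List; []; _∷_; [_]; _++_; map; filter; concatMap; upTo; applyUpTo)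
open import Data.Bool.ListAction using (all; any)
open import Data.List.Properties using (length-++; length-map; length-removeAt′; length-applyUpTo; length-upTo)
open import Data.List.Membership.Propositional using (_∈_; find; lose)
open import Data.List.Membership.Propositional.Properties
import Data.List.Membership.DecPropositional as DecMembership
open import Data.List.Relation.Binary.Subset.Propositional using (_⊆_)
open import Data.List.Relation.Unary.Any using (here; there; _─_)
open import Data.List.Relation.Unary.All as All using (All; []; _∷_)
open import Data.List.Relation.Unary.All.Properties using (all⁺)
open import Data.List.Relation.Unary.Any.Properties using (any⁻)
open import Data.List.Relation.Unary.AllPairs using ([]; _∷_)
import Data.List.Relation.Unary.AllPairs.Properties as AllPairs
open import Data.List.Relation.Unary.Unique.Propositional using (Unique)
open import Data.List.Relation.Unary.Unique.Propositional.Properties using (upTo⁺)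
open import Data.Product using (Σ; ∃; _×_; _,_; proj₁; proj₂)
open import Data.Sum using (_⊎_; inj₁; inj₂)
open import Data.Empty using (⊥)
open import Data.Unit using (tt)
open import Function using (_∘_)
open import Level using (0ℓ)
open import Function.Bundles using (Equivalence)
open import Relation.Nullary using (¬_; Dec; yes; no; contradiction)
open import Relation.Nullary.Decidable using (map′; _×-dec_)
open import Relation.Unary using (Pred; Decidable)
open import Relation.Binary.Definitions using (DecidableEquality; Tri; tri<; tri≈; tri>)
open import Relation.Binary.PropositionalEquality hiding ([_])

private
  variable
    A B : Set

⊆-∷-─ : {x : A} {ys : List A} (x∈ys : x ∈ ys) → ys ⊆ x ∷ (ys ─ x∈ys)
⊆-∷-─ (here refl) (here refl) = here refl
⊆-∷-─ (here refl) (there y∈) = there y∈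
⊆-∷-─ (there x∈) (here refl) = there (here refl)
⊆-∷-─ (there x∈) (there y∈) with ⊆-∷-─ x∈ y∈
... | here y≡x = here y≡x
... | there y∈′ = there (there y∈′)

length-≤-⊆ : {xs ys : List A} → Unique xs → xs ⊆ ys → length xs ≤ length ys
length-≤-⊆ [] _ = z≤n
length-≤-⊆ {ys = ys} (x∉xs ∷ !xs) xs⊆ys =
  subst (_ ≤_) (sym (length-removeAt′ ys _)) (s≤s (length-≤-⊆ !xs xs⊆ys─x))
  where
  x∈ys = xs⊆ys (here refl)
  xs⊆ys─x : _ ⊆ (ys ─ x∈ys)
  xs⊆ys─x y∈xs with ⊆-∷-─ x∈ys (xs⊆ys (there y∈xs))
  ... | here refl = contradiction refl (All.lookup x∉xs y∈xs)
  ... | there y∈ = y∈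

length-<-⊆ : {xs ys : List A} {y : A} → Unique xs → xs ⊆ ys →
  (y∈ys : y ∈ ys) → y ∈ (ys ─ y∈ys) → length xs < length ys
length-<-⊆ {ys = ys} !xs xs⊆ys y∈ys y∈ys─y =
  subst (_ <_) (sym (length-removeAt′ ys _)) (s≤s (length-≤-⊆ !xs (ys⊆ys─y ∘ xs⊆ys)))
  where
  ys⊆ys─y : ys ⊆ (ys ─ y∈ys)
  ys⊆ys─y z∈ys with ⊆-∷-─ y∈ys z∈ys
  ... | here refl = y∈ys─y
  ... | there z∈ = z∈

⊇-by-length : {xs ys : List A} → DecidableEquality A →
  Unique xs → xs ⊆ ys → length ys ≤ length xs → ys ⊆ xs
⊇-by-length {xs = xs} {ys} _≟_ !xs xs⊆ys ys≤xs {y} y∈ys with DecMembership._∈?_ _≟_ y xs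
... | yes y∈xs = y∈xs
... | no y∉xs = contradiction ys≤xs (<⇒≱ (length-≤-⊆ !y∷xs y∷xs⊆ys))
  where
  !y∷xs : Unique (y ∷ xs)
  !y∷xs = All.tabulate (λ z∈ y≡z → y∉xs (subst (_∈ xs) (sym y≡z) z∈)) ∷ !xs
  y∷xs⊆ys : y ∷ xs ⊆ ys
  y∷xs⊆ys (here refl) = y∈ys
  y∷xs⊆ys (there z∈) = xs⊆ys z∈

∈-++-─ : {x : A} {xs ys : List A} (x∈xs : x ∈ xs) → x ∈ ys → x ∈ ((xs ++ ys) ─ ∈-++⁺ˡ x∈xs)
∈-++-─ {xs = _ ∷ xs} (here refl) x∈ys = ∈-++⁺ʳ xs x∈ys
∈-++-─ (there x∈xs) x∈ys = there (∈-++-─ x∈xs x∈ys)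

─-++⁺ʳ : {x y : A} {ys : List A} (xs : List A) (y∈ys : y ∈ ys) →
  x ∈ (ys ─ y∈ys) → x ∈ ((xs ++ ys) ─ ∈-++⁺ʳ xs y∈ys)
─-++⁺ʳ [] y∈ys x∈ = x∈
─-++⁺ʳ (_ ∷ xs) y∈ys x∈ = there (─-++⁺ʳ xs y∈ys x∈)

∈-concatMap-twice : (f : A → List B) {a b : A} {as : List A} {y : B} →
  a ∈ as → b ∈ as → a ≢ b → y ∈ f a → y ∈ f b →
  Σ (y ∈ concatMap f as) λ y∈ → y ∈ (concatMap f as ─ y∈)
∈-concatMap-twice f (here refl) (here refl) a≢b _ _ = contradiction refl a≢b
∈-concatMap-twice f {as = _ ∷ as} (here refl) (there b∈) _ y∈fa y∈fb =
  ∈-++⁺ˡ y∈fa , ∈-++-─ y∈fa (∈-concatMap⁺ f (lose b∈ y∈fb))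
∈-concatMap-twice f {as = _ ∷ as} (there a∈) (here refl) _ y∈fa y∈fb =
  ∈-++⁺ˡ y∈fb , ∈-++-─ y∈fb (∈-concatMap⁺ f (lose a∈ y∈fa))
∈-concatMap-twice f {as = c ∷ as} (there a∈) (there b∈) a≢b y∈fa y∈fb
  with y∈ , y∈─ ← ∈-concatMap-twice f a∈ b∈ a≢b y∈fa y∈fb =
  ∈-++⁺ʳ (f c) y∈ , ─-++⁺ʳ (f c) y∈ y∈─

length-concatMap-≤ : {P : Pred A 0ℓ} (P? : Decidable P) (f : A → List B) →
  (∀ a → length (f a) ≤ 2) → (∀ a → ¬ P a → length (f a) ≤ 1) →
  ∀ as → length (concatMap f as) ≤ length as + length (filter P? as)
length-concatMap-≤ P? f _ _ [] = z≤n
length-concatMap-≤ P? f ≤2 ≤1 (a ∷ as) with P? a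
... | yes _ = begin
  length (f a ++ concatMap f as)              ≡⟨ length-++ (f a) ⟩
  length (f a) + length (concatMap f as)      ≤⟨ +-mono-≤ (≤2 a) (length-concatMap-≤ P? f ≤2 ≤1 as) ⟩
  2 + (length as + length (filter P? as))     ≡⟨ cong suc (sym (+-suc _ _)) ⟩
  suc (length as + suc (length (filter P? as))) ∎
  where open ≤-Reasoning
... | no ¬Pa = begin
  length (f a ++ concatMap f as)              ≡⟨ length-++ (f a) ⟩
  length (f a) + length (concatMap f as)      ≤⟨ +-mono-≤ (≤1 a ¬Pa) (length-concatMap-≤ P? f ≤2 ≤1 as) ⟩
  suc (length as + length (filter P? as))     ∎
  where open ≤-Reasoning

unique-map-injective : (f : A → B) {as : List A} {a b : A} →
  Unique (map f as) → a ∈ as → b ∈ as → f a ≡ f b → a ≡ b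
unique-map-injective f _ (here refl) (here refl) _ = refl
unique-map-injective f (fa∉ ∷ _) (here refl) (there b∈) fa≡fb =
  contradiction fa≡fb (All.lookup fa∉ (∈-map⁺ f b∈))
unique-map-injective f (fb∉ ∷ _) (there a∈) (here refl) fa≡fb =
  contradiction (sym fa≡fb) (All.lookup fb∉ (∈-map⁺ f a∈))
unique-map-injective f (_ ∷ !as) (there a∈) (there b∈) fa≡fb = unique-map-injective f !as a∈ b∈ fa≡fb

onlyIf : {P : Set} → Dec P → A → List A
onlyIf (yes _) a = [ a ]
onlyIf (no _)  _ = []

∈-onlyIf : {P : Set} {a : A} (P? : Dec P) → P → a ∈ onlyIf P? a
∈-onlyIf (yes _) _ = here refl
∈-onlyIf (no ¬p) p = contradiction p ¬p

length-onlyIf : {P : Set} {a : A} (P? : Dec P) → length (onlyIf P? a) ≤ 1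
length-onlyIf (yes _) = ≤-refl
length-onlyIf (no _)  = z≤n

leftEnd rightEnd : {n : ℕ} → Fin n × ℕ → ℕ
leftEnd  (v , ℓ) = toℕ v ∸ ℓ
rightEnd (v , ℓ) = toℕ v + ℓ

dominated : {n : ℕ} → Fin n × ℕ → List ℕ
dominated (v , zero) = [ toℕ v ]
dominated {n} (v , ℓ@(suc _)) = onlyIf (ℓ ≤? toℕ v) (toℕ v ∸ ℓ) ++ onlyIf (toℕ v + ℓ <? n) (toℕ v + ℓ)

dominated-sound : {n : ℕ} (p : Fin n × ℕ) (u : Fin n) → Dominates p u → toℕ u ∈ dominated p
dominated-sound (v , zero) u refl = here refl
dominated-sound {n} (v , ℓ@(suc _)) u d with ≤-total (toℕ u) (toℕ v)
... | inj₁ u≤v = ∈-++⁺ˡ {ys = onlyIf (toℕ v + ℓ <? n) (toℕ v + ℓ)}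
        (subst (_∈ _) v∸ℓ≡u (∈-onlyIf (ℓ ≤? toℕ v) ℓ≤v))
  where
  v∸u≡ℓ : toℕ v ∸ toℕ u ≡ ℓ
  v∸u≡ℓ = trans (sym (m≤n⇒∣m-n∣≡n∸m u≤v)) d
  ℓ≤v : ℓ ≤ toℕ v
  ℓ≤v = subst (_≤ toℕ v) v∸u≡ℓ (m∸n≤m (toℕ v) (toℕ u))
  v∸ℓ≡u : toℕ v ∸ ℓ ≡ toℕ u
  v∸ℓ≡u = trans (cong (toℕ v ∸_) (sym v∸u≡ℓ)) (m∸[m∸n]≡n u≤v)
... | inj₂ v≤u = ∈-++⁺ʳ (onlyIf (ℓ ≤? toℕ v) (toℕ v ∸ ℓ))
        (subst (_∈ _) v+ℓ≡u (∈-onlyIf (toℕ v + ℓ <? n) v+ℓ<n))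
  where
  v+ℓ≡u : toℕ v + ℓ ≡ toℕ u
  v+ℓ≡u = trans (cong (toℕ v +_) (trans (sym d) (m≤n⇒∣n-m∣≡n∸m v≤u))) (m+[n∸m]≡n v≤u)
  v+ℓ<n : toℕ v + ℓ < n
  v+ℓ<n = subst (_< n) (sym v+ℓ≡u) (toℕ<n u)

record Good {n : ℕ} (p : Fin n × ℕ) : Set where
  constructor good
  field
    label>0      : 0 < proj₂ p
    label≤vertex : proj₂ p ≤ toℕ (proj₁ p)
    rightEnd<n   : rightEnd p < n

good? : {n : ℕ} → Decidable (Good {n})
good? {n} (v , ℓ) = map′ (λ (a , b , c) → good a b c) (λ (good a b c) → a , b , c)
  (0 <? ℓ ×-dec ℓ ≤? toℕ v ×-dec toℕ v + ℓ <? n)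

length-dominated≤2 : {n : ℕ} (p : Fin n × ℕ) → length (dominated p) ≤ 2
length-dominated≤2 (v , zero) = s≤s z≤n
length-dominated≤2 {n} (v , suc ℓ) =
  subst (_≤ 2) (sym (length-++ (onlyIf (suc ℓ ≤? toℕ v) _)))
    (+-mono-≤ (length-onlyIf (suc ℓ ≤? toℕ v)) (length-onlyIf (toℕ v + suc ℓ <? n)))

length-dominated≤1 : {n : ℕ} (p : Fin n × ℕ) → ¬ Good p → length (dominated p) ≤ 1
length-dominated≤1 (v , zero) _ = ≤-refl
length-dominated≤1 {n} (v , suc ℓ) ¬good with suc ℓ ≤? toℕ v | toℕ v + suc ℓ <? n
... | yes ℓ≤v | yes v+ℓ<n = contradiction (good z<s ℓ≤v v+ℓ<n) ¬good
... | yes _   | no _      = ≤-refl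
... | no _    | yes _     = ≤-refl
... | no _    | no _      = z≤n

leftEnd∈dominated : {n : ℕ} {p : Fin n × ℕ} → Good p → leftEnd p ∈ dominated p
leftEnd∈dominated {p = v , suc ℓ} g = ∈-++⁺ˡ (∈-onlyIf (suc ℓ ≤? toℕ v) (Good.label≤vertex g))

rightEnd∈dominated : {n : ℕ} {p : Fin n × ℕ} → Good p → rightEnd p ∈ dominated p
rightEnd∈dominated {n} {v , suc ℓ} g = ∈-++⁺ʳ _ (∈-onlyIf (toℕ v + suc ℓ <? n) (Good.rightEnd<n g))

leftEnd+label≡vertex : {n : ℕ} {p : Fin n × ℕ} → Good p → leftEnd p + proj₂ p ≡ toℕ (proj₁ p)
leftEnd+label≡vertex g = m∸n+n≡m (Good.label≤vertex g)

good⇒label+label<n : {n : ℕ} {p : Fin n × ℕ} → Good p → proj₂ p + proj₂ p < n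
good⇒label+label<n g = ≤-<-trans (+-monoˡ-≤ _ (Good.label≤vertex g)) (Good.rightEnd<n g)

module _ {n : ℕ} (D : ExtIrrDomSet n) where
  open ExtIrrDomSet D

  vertex-injective : {p q : Fin n × ℕ} → p ∈ elems → q ∈ elems →
    toℕ (proj₁ p) ≡ toℕ (proj₁ q) → p ≡ q
  vertex-injective p∈ q∈ = unique-map-injective proj₁ distinctV p∈ q∈ ∘ toℕ-injective

  label-injective : {p q : Fin n × ℕ} → p ∈ elems → q ∈ elems → proj₂ p ≡ proj₂ q → p ≡ q
  label-injective = unique-map-injective proj₂ injLabel

  record GoodHolder (t : ℕ) : Set where
    field
      holder       : Fin n × ℕ
      holder∈      : holder ∈ elems
      holder-good  : Good holder
      holder-label : proj₂ holder ≡ t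

  record Tight : Set where
    field
      exclusive : {p q : Fin n × ℕ} {x : ℕ} → p ∈ elems → q ∈ elems → p ≢ q →
        x ∈ dominated p → x ∈ dominated q → ⊥
      labelled : ∀ t → 0 < t → t + t < n → GoodHolder t

m+m<n⇒m≤⌊pred[n]/2⌋ : ∀ {ℓ n} → ℓ + ℓ < n → ℓ ≤ ⌊ pred n /2⌋
m+m<n⇒m≤⌊pred[n]/2⌋ {ℓ} ℓ+ℓ<n = subst (_≤ _) (sym (n≡⌊n+n/2⌋ ℓ)) (⌊n/2⌋-mono (pred-mono-≤ ℓ+ℓ<n))

small⇒tight : {n : ℕ} (D : ExtIrrDomSet n) →
  length (ExtIrrDomSet.elems D) + ⌊ pred n /2⌋ ≤ n → Tight D
small⇒tight {n} D budget = record { exclusive = exclusive ; labelled = labelled }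
  where
  open ExtIrrDomSet D
  covered goodLabels : List ℕ
  covered = concatMap dominated elems
  goodLabels = map proj₂ (filter good? elems)

  k h g : ℕ
  k = length elems
  h = ⌊ pred n /2⌋
  g = length goodLabels

  covers : upTo n ⊆ covered
  covers u∈ with p , p∈ , d ← find (dominating (fromℕ< (∈-upTo⁻ u∈))) =
    ∈-concatMap⁺ dominated (lose p∈ (subst (_∈ dominated p) (toℕ-fromℕ< _) (dominated-sound p _ d)))

  covered-bound : length covered ≤ k + g
  covered-bound = subst (λ l → length covered ≤ k + l) (sym (length-map proj₂ (filter good? elems)))
    (length-concatMap-≤ good? dominated length-dominated≤2 length-dominated≤1 elems)

  goodLabels-unique : Unique goodLabels
  goodLabels-unique = AllPairs.map⁺ (AllPairs.filter⁺ good? (AllPairs.map⁻ injLabel))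

  goodLabels⊆ : goodLabels ⊆ applyUpTo suc h
  goodLabels⊆ t∈ with p , _ , refl , g ← ∈-map∘filter⁻ proj₂ good? {xs = elems} t∈ with Good.label>0 g
  ... | s≤s _ = ∈-applyUpTo⁺ suc (m+m<n⇒m≤⌊pred[n]/2⌋ (good⇒label+label<n g))

  n≤k+g : n ≤ k + g
  n≤k+g = ≤-trans (subst (_≤ length covered) (length-upTo n) (length-≤-⊆ (upTo⁺ n) covers))
                  covered-bound

  g≤h : g ≤ h
  g≤h = subst (g ≤_) (length-applyUpTo suc h) (length-≤-⊆ goodLabels-unique goodLabels⊆)

  h≤g : h ≤ g
  h≤g = +-cancelˡ-≤ k h g (≤-trans budget n≤k+g)

  exclusive : {p q : Fin n × ℕ} {x : ℕ} → p ∈ elems → q ∈ elems → p ≢ q →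
    x ∈ dominated p → x ∈ dominated q → ⊥
  exclusive p∈ q∈ p≢q x∈p x∈q with x∈ , x∈─ ← ∈-concatMap-twice dominated p∈ q∈ p≢q x∈p x∈q =
    <-irrefl refl (begin-strict
      n               ≡⟨ length-upTo n ⟨
      length (upTo n) <⟨ length-<-⊆ (upTo⁺ n) covers x∈ x∈─ ⟩
      length covered  ≤⟨ covered-bound ⟩
      k + g           ≤⟨ +-monoʳ-≤ k g≤h ⟩
      k + h           ≤⟨ budget ⟩
      n               ∎)
    where open ≤-Reasoning

  goodLabels⊇ : applyUpTo suc h ⊆ goodLabels
  goodLabels⊇ = ⊇-by-length _≟_ goodLabels-unique goodLabels⊆
    (subst (_≤ g) (sym (length-applyUpTo suc h)) h≤g)

  labelled : ∀ t → 0 < t → t + t < n → GoodHolder D t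
  labelled (suc t) _ t+t<n
    with p , p∈ , refl , g ← ∈-map∘filter⁻ proj₂ good? {xs = elems}
           (goodLabels⊇ (∈-applyUpTo⁺ suc (m+m<n⇒m≤⌊pred[n]/2⌋ t+t<n)))
    = record { holder = p ; holder∈ = p∈ ; holder-good = g ; holder-label = refl }

-- For n = 2m, slot i stands for the label m ∸ i and is placed at the left end a of its carrier,
-- which then sits at a + (m ∸ i) and also dominates a + 2(m ∸ i).  Two placed slots clash when
-- they share a left end, a carrier or a right end, or (if c holds) when a right end meets a left
-- end; only the last two conditions involve m.
clashes : Bool → ℕ → ℕ × ℕ → ℕ × ℕ → Bool
clashes c m (i , a) (j , b) =
  (a ≡ᵇ b) ∨ (a + j ≡ᵇ b + i) ∨ (a + j + j ≡ᵇ b + i + i) ∨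
  (c ∧ ((a + m + m ≡ᵇ b + i + i) ∨ (b + m + m ≡ᵇ a + j + j)))

-- Every placement b < 2k of the slots k = j, …, j + d ∸ 1 clashes with one already placed.
refutes : Bool → ℕ → (d j : ℕ) → List (ℕ × ℕ) → Bool
refutes c m zero    j placed = false
refutes c m (suc d) j placed = all (λ b →
    any (λ s → clashes c m s (j , b)) placed ∨ refutes c m d (suc j) ((j , b) ∷ placed))
  (upTo (j + j))

refutes-sound : ∀ c m (R : ℕ → ℕ → Set) →
  (∀ {i a} → R i a → a < i + i) →
  (∀ {i a j b} → R i a → R j b → i ≢ j → ¬ T (clashes c m (i , a) (j , b))) →
  ∀ d j placed → T (refutes c m d j placed) → All (λ (i , a) → i < j × R i a) placed →
  (∀ i → j ≤ i → i < j + d → ∃ (R i)) → ⊥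
refutes-sound c m R bounded clash-free (suc d) j placed t placed-ok fill
  with b , Rjb ← fill j ≤-refl (m<m+n j z<s)
  with Equivalence.to T-∨ (All.lookup (all⁺ _ _ t) (∈-upTo⁺ (bounded Rjb)))
... | inj₁ clash
  with (i , a) , s∈ , clash-ij ← find (any⁻ _ placed clash)
  with i<j , Ria ← All.lookup placed-ok s∈ = clash-free Ria Rjb (<⇒≢ i<j) clash-ij
... | inj₂ deeper = refutes-sound c m R bounded clash-free d (suc j) ((j , b) ∷ placed) deeper
  ((≤-refl , Rjb) ∷ All.map (λ (i<j , Ria) → m<n⇒m<1+n i<j , Ria) placed-ok)
  (λ i j<i i<j+d → fill i (<⇒≤ j<i) (subst (i <_) (sym (+-suc j d)) i<j+d))

-- Over ℤ: a − i = b − j forces a + (m − i) = b + (m − j); then the doubled and one-sided forms.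
complement-shift : ∀ {i j ℓ ℓ′ m} a b → i + ℓ ≡ m → j + ℓ′ ≡ m → a + j ≡ b + i → a + ℓ ≡ b + ℓ′
complement-shift {i} {j} {ℓ} {ℓ′} a b refl j+ℓ′≡m a+j≡b+i = +-cancelʳ-≡ (i + j) _ _ (begin
  a + ℓ + (i + j)      ≡⟨ swap a ℓ i j ⟩
  (a + j) + (i + ℓ)    ≡⟨ cong₂ _+_ a+j≡b+i (sym j+ℓ′≡m) ⟩
  (b + i) + (j + ℓ′)   ≡⟨ swap b i j ℓ′ ⟩
  b + ℓ′ + (j + i)     ≡⟨ cong (b + ℓ′ +_) (+-comm j i) ⟩
  b + ℓ′ + (i + j)     ∎)
  where
  open ≡-Reasoning
  swap : ∀ w x y z → w + x + (y + z) ≡ w + z + (y + x)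
  swap = solve-∀

complement-shift₂ : ∀ {i j ℓ ℓ′ m} a b → i + ℓ ≡ m → j + ℓ′ ≡ m →
  a + j + j ≡ b + i + i → a + ℓ + ℓ ≡ b + ℓ′ + ℓ′
complement-shift₂ {i} {j} {ℓ} {ℓ′} a b i+ℓ≡m j+ℓ′≡m e = complement-shift (a + ℓ) (b + ℓ′) i+ℓ≡m j+ℓ′≡m
  (trans (swap a ℓ j) (trans (complement-shift (a + j) (b + i) i+ℓ≡m j+ℓ′≡m e) (swap b i ℓ′)))
  where
  swap : ∀ x y z → x + y + z ≡ x + z + y
  swap = solve-∀

complement-unshift₂ : ∀ {i ℓ m} a b → i + ℓ ≡ m → a + m + m ≡ b + i + i → a + ℓ + ℓ ≡ b
complement-unshift₂ {i} {ℓ} a b refl e =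
  +-cancelʳ-≡ (i + i) _ _ (trans (regroup a ℓ i) (trans e (+-assoc b i i)))
  where
  regroup : ∀ x y z → x + y + y + (z + z) ≡ x + (z + y) + (z + y)
  regroup = solve-∀

module EvenPath {m : ℕ} (D : ExtIrrDomSet (m + m)) (tightD : Tight D) where
  open ExtIrrDomSet D
  open Tight tightD

  record Placed (i a : ℕ) : Set where
    field
      owner      : Fin (m + m) × ℕ
      owner∈     : owner ∈ elems
      owner-good : Good owner
      slot       : i + proj₂ owner ≡ m
      left       : leftEnd owner ≡ a

    label : ℕ
    label = proj₂ owner

    left∈ : a ∈ dominated owner
    left∈ = subst (_∈ dominated owner) left (leftEnd∈dominated owner-good)

    vertex : toℕ (proj₁ owner) ≡ a + label
    vertex = trans (sym (leftEnd+label≡vertex owner-good)) (cong (_+ label) left)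

    right∈ : a + label + label ∈ dominated owner
    right∈ = subst (_∈ dominated owner) (cong (_+ label) vertex) (rightEnd∈dominated owner-good)

  placeable : ∀ i → 0 < i → i < m → ∃ (Placed i)
  placeable i 0<i i<m = leftEnd holder , record
    { owner = holder ; owner∈ = holder∈ ; owner-good = holder-good
    ; slot = trans (cong (i +_) holder-label) i+ℓ≡m ; left = refl }
    where
    i+ℓ≡m : i + (m ∸ i) ≡ m
    i+ℓ≡m = m+[n∸m]≡n (<⇒≤ i<m)
    ℓ<m : m ∸ i < m
    ℓ<m = subst (m ∸ i <_) i+ℓ≡m (m<n+m (m ∸ i) 0<i)
    open GoodHolder (labelled (m ∸ i) (m<n⇒0<n∸m i<m) (+-mono-< ℓ<m ℓ<m))

  placed-bounded : ∀ {i a} → Placed i a → a < i + i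
  placed-bounded {i} {a} P = +-cancelʳ-< (ℓ + ℓ) a (i + i) (begin-strict
    a + (ℓ + ℓ)         ≡⟨ +-assoc a ℓ ℓ ⟨
    a + ℓ + ℓ           ≡⟨ cong (_+ ℓ) vertex ⟨
    rightEnd owner      <⟨ Good.rightEnd<n owner-good ⟩
    m + m               ≡⟨ cong₂ _+_ slot slot ⟨
    (i + ℓ) + (i + ℓ)   ≡⟨ regroup i ℓ ⟩
    (i + i) + (ℓ + ℓ)   ∎)
    where
    open Placed P
    ℓ : ℕ
    ℓ = label
    open ≤-Reasoning
    regroup : ∀ x y → x + y + (x + y) ≡ x + x + (y + y)
    regroup = solve-∀

  placed-clash-free : ∀ c {i a j b} → Placed i a → Placed j b → i ≢ j →
    ¬ T (clashes c m (i , a) (j , b))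
  placed-clash-free c {i} {a} {j} {b} P Q i≢j = refute
    where
    module P = Placed P
    module Q = Placed Q

    owners-differ : P.owner ≢ Q.owner
    owners-differ P≡Q = i≢j (+-cancelʳ-≡ P.label i j
      (trans P.slot (trans (sym Q.slot) (cong (λ p → j + proj₂ p) (sym P≡Q)))))

    meet : ∀ {x y} → x ∈ dominated P.owner → y ∈ dominated Q.owner → x ≡ y → ⊥
    meet x∈ y∈ refl = exclusive P.owner∈ Q.owner∈ owners-differ x∈ y∈

    refute : ¬ T (clashes c m (i , a) (j , b))
    refute t with Equivalence.to (T-∨ {a ≡ᵇ b}) t
    ... | inj₁ left = meet P.left∈ Q.left∈ (≡ᵇ⇒≡ a b left)
    ... | inj₂ t with Equivalence.to (T-∨ {a + j ≡ᵇ b + i}) t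
    ... | inj₁ centre = owners-differ (vertex-injective D P.owner∈ Q.owner∈ (begin
            toℕ (proj₁ P.owner) ≡⟨ P.vertex ⟩
            a + P.label         ≡⟨ complement-shift a b P.slot Q.slot (≡ᵇ⇒≡ (a + j) (b + i) centre) ⟩
            b + Q.label         ≡⟨ Q.vertex ⟨
            toℕ (proj₁ Q.owner) ∎))
      where open ≡-Reasoning
    ... | inj₂ t with Equivalence.to (T-∨ {a + j + j ≡ᵇ b + i + i}) t
    ... | inj₁ right = meet P.right∈ Q.right∈
            (complement-shift₂ a b P.slot Q.slot (≡ᵇ⇒≡ (a + j + j) (b + i + i) right))
    ... | inj₂ t with Equivalence.to (T-∨ {a + m + m ≡ᵇ b + i + i}) (proj₂ (Equivalence.to (T-∧ {c}) t))
    ... | inj₁ right-left = meet P.right∈ Q.left∈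
            (complement-unshift₂ a b P.slot (≡ᵇ⇒≡ (a + m + m) (b + i + i) right-left))
    ... | inj₂ left-right = meet P.left∈ Q.right∈
            (sym (complement-unshift₂ b a Q.slot (≡ᵇ⇒≡ (b + m + m) (a + j + j) left-right)))

  refuted : ∀ c d → d < m → ¬ T (refutes c m d 1 [])
  refuted c d d<m t = refutes-sound c m Placed placed-bounded (placed-clash-free c) d 1 [] t []
    (λ i 1≤i i≤d → placeable i 1≤i (≤-<-trans (s≤s⁻¹ i≤d) d<m))

¬Tight-odd : ∀ m → 2 ≤ m → (D : ExtIrrDomSet (suc (m + m))) → ¬ Tight D
¬Tight-odd m@(suc m′) (s≤s 0<m′) D tightD = by-position (<-cmp w m)
  where
  open Tight tightD
  module P = GoodHolder (labelled m z<s ≤-refl)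
  module Q = GoodHolder (labelled m′ 0<m′ (s≤s (+-mono-≤ (n≤1+n m′) (n≤1+n m′))))
  v w : ℕ
  v = toℕ (proj₁ P.holder)
  w = toℕ (proj₁ Q.holder)

  P≢Q : P.holder ≢ Q.holder
  P≢Q P≡Q = 1+n≢n (trans (sym P.holder-label) (trans (cong proj₂ P≡Q) Q.holder-label))

  meet : ∀ {x y} → x ∈ dominated P.holder → y ∈ dominated Q.holder → x ≡ y → ⊥
  meet x∈ y∈ refl = exclusive P.holder∈ Q.holder∈ P≢Q x∈ y∈

  v+m≤m+m : v + m ≤ m + m
  v+m≤m+m = s≤s⁻¹ (subst (λ ℓ → v + ℓ < suc (m + m)) P.holder-label (Good.rightEnd<n P.holder-good))

  w+m′≤m+m : w + m′ ≤ m + m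
  w+m′≤m+m = s≤s⁻¹ (subst (λ ℓ → w + ℓ < suc (m + m)) Q.holder-label (Good.rightEnd<n Q.holder-good))

  v≡m : v ≡ m
  v≡m = ≤-antisym (+-cancelʳ-≤ m v m v+m≤m+m)
                  (subst (_≤ v) P.holder-label (Good.label≤vertex P.holder-good))

  by-position : Tri (w < m) (w ≡ m) (w > m) → ⊥
  by-position (tri≈ _ w≡m _) = P≢Q (vertex-injective D P.holder∈ Q.holder∈ (trans v≡m (sym w≡m)))
  by-position (tri< w<m _ _) = meet (leftEnd∈dominated P.holder-good) (leftEnd∈dominated Q.holder-good)
    (trans P-left≡0 (sym Q-left≡0))
    where
    P-left≡0 : v ∸ proj₂ P.holder ≡ 0
    P-left≡0 = trans (cong₂ _∸_ v≡m P.holder-label) (n∸n≡0 m)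
    Q-left≡0 : w ∸ proj₂ Q.holder ≡ 0
    Q-left≡0 = m≤n⇒m∸n≡0 (subst (w ≤_) (sym Q.holder-label) (s≤s⁻¹ w<m))
  by-position (tri> _ _ m<w) = meet (rightEnd∈dominated P.holder-good) (rightEnd∈dominated Q.holder-good)
    (trans P-right≡m+m (sym Q-right≡m+m))
    where
    P-right≡m+m : v + proj₂ P.holder ≡ m + m
    P-right≡m+m = cong₂ _+_ v≡m P.holder-label
    m+m≤w+m′ : m + m ≤ w + m′
    m+m≤w+m′ = subst (_≤ w + m′) (sym (+-suc m m′)) (+-monoˡ-≤ m′ m<w)
    Q-right≡m+m : w + proj₂ Q.holder ≡ m + m
    Q-right≡m+m = trans (cong (w +_) Q.holder-label) (≤-antisym w+m′≤m+m m+m≤w+m′)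

P₄-unique-far-vertex : (v w u : Fin 4) → Good (v , 1) →
  w ≢ v → pathDist w v ≢ 1 → 2 ≤ pathDist v u → u ≡ w
P₄-unique-far-vertex 0F _ _ (good _ () _)
P₄-unique-far-vertex 3F _ _ (good _ _ (s≤s (s≤s (s≤s (s≤s ())))))
P₄-unique-far-vertex 1F 0F _ _ _ w-off _ = contradiction refl w-off
P₄-unique-far-vertex 1F 1F _ _ w≢v _ _ = contradiction refl w≢v
P₄-unique-far-vertex 1F 2F _ _ _ w-off _ = contradiction refl w-off
P₄-unique-far-vertex 1F 3F 0F _ _ _ (s≤s ())
P₄-unique-far-vertex 1F 3F 1F _ _ _ ()
P₄-unique-far-vertex 1F 3F 2F _ _ _ (s≤s ())
P₄-unique-far-vertex 1F 3F 3F _ _ _ _ = refl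
P₄-unique-far-vertex 2F 0F 0F _ _ _ _ = refl
P₄-unique-far-vertex 2F 0F 1F _ _ _ (s≤s ())
P₄-unique-far-vertex 2F 0F 2F _ _ _ ()
P₄-unique-far-vertex 2F 0F 3F _ _ _ (s≤s ())
P₄-unique-far-vertex 2F 1F _ _ _ w-off _ = contradiction refl w-off
P₄-unique-far-vertex 2F 2F _ _ w≢v _ _ = contradiction refl w≢v
P₄-unique-far-vertex 2F 3F _ _ _ w-off _ = contradiction refl w-off

-- In a tight P₄ the vertex carrying label 1 is interior and dominated by nobody.
¬Tight-P₄ : (D : ExtIrrDomSet 4) → ¬ Tight D
¬Tight-P₄ D tightD = from-holder (labelled 1 z<s (s≤s (s≤s (s≤s z≤n))))
  where
  open ExtIrrDomSet D
  open Tight tightD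
  from-holder : GoodHolder D 1 → ⊥
  from-holder record { holder = v , _ ; holder∈ = p∈ ; holder-good = g ; holder-label = refl }
    with (w , _) , z∈ , refl ← find hasZero
    with (u , ℓ) , r∈ , r-dom ← find (dominating v)
    = dominator ℓ r∈ r-dom
    where
    w≢v : w ≢ v
    w≢v w≡v = 0≢1+n (cong proj₂ (vertex-injective D z∈ p∈ (cong toℕ w≡v)))
    w-off : pathDist w v ≢ 1
    w-off d = exclusive z∈ p∈ (λ ()) (here refl) (dominated-sound (v , 1) w d)
    dominator : ∀ {u} ℓ → (u , ℓ) ∈ elems → Dominates (u , ℓ) v → ⊥
    dominator zero r∈ refl = 0≢1+n (cong proj₂ (vertex-injective D r∈ p∈ refl))
    dominator 1 r∈ d with refl ← label-injective D r∈ p∈ refl =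
      0≢1+n (trans (sym (m≡n⇒∣m-n∣≡0 {toℕ v} refl)) d)
    dominator {u} (suc (suc k)) r∈ d
      with refl ← P₄-unique-far-vertex v w u g w≢v w-off (subst (2 ≤_) (sym d) (s≤s (s≤s z≤n)))
      = 0≢1+n (sym (cong proj₂ (vertex-injective D r∈ z∈ refl)))

-- For m ≥ 8 already the seven largest labels cannot be placed, even ignoring the two clashes
-- that involve m; for m ∈ {4, 6, 7} the search places all labels and uses all clashes.
¬Tight-even : ∀ m → 2 ≤ m → m ≢ 3 → m ≢ 5 → (D : ExtIrrDomSet (m + m)) → ¬ Tight D
¬Tight-even 1 (s≤s ())
¬Tight-even 2 _ _ _ D = ¬Tight-P₄ D
¬Tight-even 3 _ m≢3 _ _ _ = m≢3 refl
¬Tight-even 4 _ _ _ D tightD = EvenPath.refuted D tightD true 3 ≤-refl tt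
¬Tight-even 5 _ _ m≢5 _ _ = m≢5 refl
¬Tight-even 6 _ _ _ D tightD = EvenPath.refuted D tightD true 5 ≤-refl tt
¬Tight-even 7 _ _ _ D tightD = EvenPath.refuted D tightD true 6 ≤-refl tt
¬Tight-even (suc (suc (suc (suc (suc (suc (suc (suc j)))))))) _ _ _ D tightD =
  EvenPath.refuted D tightD false 7 (s≤s (s≤s (s≤s (s≤s (s≤s (s≤s (s≤s (s≤s z≤n)))))))) tt

even-or-odd : ∀ n → ∃ λ m → n ≡ m + m ⊎ n ≡ suc (m + m)
even-or-odd zero = 0 , inj₁ refl
even-or-odd (suc zero) = 0 , inj₂ refl
even-or-odd (suc (suc n)) with even-or-odd n
... | m , inj₁ refl = suc m , inj₁ (cong suc (sym (+-suc m m)))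
... | m , inj₂ refl = suc m , inj₂ (cong (suc ∘ suc) (sym (+-suc m m)))

¬Tight : {n : ℕ} → 4 ≤ n → n ≢ 6 → n ≢ 10 → (D : ExtIrrDomSet n) → ¬ Tight D
¬Tight {n} 4≤n n≢6 n≢10 with even-or-odd n
... | m , inj₁ refl = ¬Tight-even m (≮⇒≥ λ m<2 → <⇒≱ (+-mono-< m<2 m<2) 4≤n)
  (n≢6 ∘ cong (λ x → x + x)) (n≢10 ∘ cong (λ x → x + x))
... | m , inj₂ refl = ¬Tight-odd m
  (≮⇒≥ λ m<2 → <⇒≱ (s≤s (s≤s (+-mono-≤ (s≤s⁻¹ m<2) (s≤s⁻¹ m<2)))) 4≤n)

<⌈[1+n+3]/2⌉⇒+⌊n/2⌋≤1+n : ∀ n {k} → k < ⌈ (suc n + 3) /2⌉ → k + ⌊ n /2⌋ ≤ suc n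
<⌈[1+n+3]/2⌉⇒+⌊n/2⌋≤1+n n {k} k<⌈⌉ = begin
  k + ⌊ n /2⌋              ≤⟨ +-monoˡ-≤ ⌊ n /2⌋ (s≤s⁻¹ (subst (k <_) ⌈suc[n]+3/2⌉ k<⌈⌉)) ⟩
  suc (⌈ n /2⌉ + ⌊ n /2⌋)  ≡⟨ cong suc (trans (+-comm ⌈ n /2⌉ ⌊ n /2⌋) (⌊n/2⌋+⌈n/2⌉≡n n)) ⟩
  suc n                    ∎
  where
  open ≤-Reasoning
  ⌈suc[n]+3/2⌉ : ⌈ (suc n + 3) /2⌉ ≡ suc (suc ⌈ n /2⌉)
  ⌈suc[n]+3/2⌉ = cong (λ x → suc ⌊ x /2⌋) (+-comm n 3)

corollary5p8 : (n : ℕ) → 4 ≤ n → n ≢ 6 → n ≢ 10 →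
    (D : ExtIrrDomSet n) →
    ⌈ (n + 3) /2⌉ ≤ length (ExtIrrDomSet.elems D)
corollary5p8 (suc n) 4≤n n≢6 n≢10 D =
  ≮⇒≥ λ short → ¬Tight 4≤n n≢6 n≢10 D (small⇒tight D (<⌈[1+n+3]/2⌉⇒+⌊n/2⌋≤1+n n short))
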